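{- Let $G$ be a finite group of order $n=(z+r)^2+z+1$ and let $S=S_1\cup S_2\subseteq G\setminus\{1\}$ with $S_1=S_1^{ -1}$, $S_2\cap S_2^{ -1}=\emptyset$, $|S_1|=r$, $|S_2|=z$, such that the Cayley graph $\mathrm{Cay}(G,S)$ is a mixed Moore graph of diameter 2, undirected degree $r$ and directed degree $z$. Suppose further that $G$ has a subgroup $H$ of index 2, and let $s_1=|S_1\cap H|$ and $s_2=|S_2\cap H|$. Then \[s_1+s_2=\frac{2(z+r)-1\pm\sqrt{4r-3}}{4},\] i.e. $s_1+s_2$ equals one of the two values $\frac{2(z+r)-1+\sqrt{4r-3}}{4}$, $\frac{2(z+r)-1-\sqrt{4r-3}}{4}$.
   Context: For a finite group $G$ and $S\subseteq G\setminus\{1\}$, the Cayley graph $\mathrm{Cay}(G,S)$ has vertex set $G$ and an arc from $g$ to $gs$ for every $g\in G$, $s\in S$; when $s,s^{ -1}\in S$ the pair of arcs between $g$ and $gs$ is regarded as one undirected edge. With $S=S_1\cup S_2$, $S_1=S_1^{ -1}$, $S_2\cap S_2^{ -1}=\emptyset$, this is a mixed graph of undirected degree $|S_1|$ and directed out-degree $|S_2|$. Undirected edges may be traversed in either direction and arcs only in their direction; distance and diameter are defined accordingly. A mixed Moore graph of diameter 2, undirected degree $r$ and directed degree $z$ is a mixed graph of diameter 2 with every vertex having at most $r$ undirected edges and at most $z$ out-arcs, and with exactly $(z+r)^2+z+1$ vertices. -}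

module Defs where

open import Data.Nat using (ℕ; _+_; _*_; _^_)
open import Data.Fin using (Fin)
open import Data.Fin.Subset using (Subset; _∈_; _∉_; _∩_; ∣_∣)
open import Data.Product using (Σ; ∃; _×_)
open import Data.Sum using (_⊎_)
open import Relation.Binary.PropositionalEquality using (_≡_)
open import Algebra.Core using (Op₁; Op₂)
open import Algebra.Structures using (IsGroup)

record FiniteGroup (n : ℕ) : Set where
  field
    _∙_     : Op₂ (Fin n)
    ε       : Fin n
    _⁻¹     : Op₁ (Fin n)
    isGroup : IsGroup _≡_ _∙_ ε _⁻¹
  infixl 7 _∙_
  infix 8 _⁻¹

module _ {n : ℕ} (G : FiniteGroup n) where
  open FiniteGroup G

  InverseClosed : Subset n → Set
  InverseClosed A = ∀ x → x ∈ A → x ⁻¹ ∈ A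

  NoInverses : Subset n → Set
  NoInverses A = ∀ x → x ∈ A → x ⁻¹ ∉ A

  Arc : Subset n → Fin n → Fin n → Set
  Arc S g h = ∃ λ s → s ∈ S × h ≡ g ∙ s

  -- Cay(G,S) has diameter at most 2: every vertex h is reachable from every g
  -- by a walk of length 0, 1 or 2 (undirected edges appear as a pair of opposite arcs).
  DiameterAtMost2 : Subset n → Set
  DiameterAtMost2 S = ∀ g h → h ≡ g ⊎ Arc S g h ⊎ ∃ λ k → Arc S g k × Arc S k h

  IsSubgroupIndex2 : Subset n → Set
  IsSubgroupIndex2 H =
    ε ∈ H × (∀ x y → x ∈ H → y ∈ H → x ∙ y ∈ H) × (∀ x → x ∈ H → x ⁻¹ ∈ H)
    × 2 * ∣ H ∣ ≡ n

  MixedMooreCayley : (r z : ℕ) → Subset n → Subset n → Set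
  MixedMooreCayley r z S₁ S₂ =
    n ≡ (z + r) ^ 2 + z + 1
    × ε ∉ S₁ × ε ∉ S₂
    × (∀ x → x ∈ S₁ → x ∉ S₂)
    × InverseClosed S₁ × NoInverses S₂
    × ∣ S₁ ∣ ≡ r × ∣ S₂ ∣ ≡ z
    × DiameterAtMost2 (S₁ Data.Fin.Subset.∪ S₂)

module Submission where

-- Let w(x) = δ(x) + χ_S(x) + #{(s, t) ∈ S² : s t = x} count the walks of length at most 2 from ε to x
-- in Cay(G, S), k = |S| = z + r. The diameter gives w(x) ≥ 1, and the r undirected edges at ε give
-- w(ε) ≥ 1 + r; as Σ w = 1 + k + k² = n + r, both bounds are equalities. Summing w over the
-- index-2 subgroup H, where s t ∈ H iff s and t lie in the same coset, gives
-- 1 + a + a² + b² = |H| + r = n/2 + r for a = |S ∩ H|, b = |S ∖ H|, a + b = k. This says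
-- r = (a - b)² + (a - b) + 1, i.e. (4a - 2k + 1)² = 4r - 3.

open import Defs
open import Data.Nat as ℕ using (ℕ; suc; _+_; _*_; _∸_; _^_; _≤_; z≤n)
open import Data.Nat.Properties
  using (≤-refl; ≤-reflexive; ≤-trans; ≤-antisym; module ≤-Reasoning; +-mono-≤; +-cancelˡ-≤; m≤m+n; m≤n+m;
         n≤0⇒n≡0; m∸n≡0⇒m≤n; m+[n∸m]≡n; m+n∸m≡n; +-comm; +-identityʳ; +-cancelʳ-≡;
         *-identityˡ; *-identityʳ; *-zeroˡ; *-assoc; *-distribˡ-+; *-distribʳ-+; +-*-semiring)
open import Data.Bool using (Bool; true; false; _∧_; _∨_)
open import Data.Fin as Fin using (Fin; _≟_)
open import Data.Fin.Subset using (Subset; _∈_; _∉_; _∩_; _∪_; ∁; ⊤; ⁅_⁆; _⊆_; ∣_∣)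
open import Data.Fin.Subset.Properties
  using (_∈?_; p⊆p∪q; x∈⁅x⁆; x≢y⇒x∉⁅y⁆; ∣⁅x⁆∣≡1; x∉p⇒x∈∁p; x∈p⇒x∉∁p; x∈p∩q⁻; p∩q⊆p; ∣∁p∣≡n∸∣p∣;
         ∣⊥∣≡0; Empty-unique; ∩-distribˡ-∪; ∩-distribʳ-∪; ∩-identityʳ; p∪∁p≡⊤)
open import Data.Fin.Permutation using (permutation)
open import Data.Vec using (lookup; []; _∷_)
open import Data.Vec.Properties using (lookup-zipWith; []=⇒lookup; lookup⇒[]=)
open import Data.Product using (_,_; proj₂)
open import Data.Sum using (inj₁; inj₂)
open import Data.Integer using (ℤ; +_) renaming (_+_ to _+ℤ_; _-_ to _-ℤ_; _*_ to _*ℤ_)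
open import Data.Integer.Properties using (pos-+; pos-*)
open import Relation.Nullary using (yes; no; contradiction)
open import Relation.Binary.PropositionalEquality
open import Algebra.Bundles using (Group)
open import Level using (0ℓ)
open import Algebra.Structures using (IsGroup)
import Algebra.Properties.Group as GroupProperties
open import Algebra.Properties.Semiring.Sum +-*-semiring
  using (sum; sum-cong-≗; sum-remove; ∑-distrib-+; ∑-comm; ∑-permute; *-distribˡ-sum; *-distribʳ-sum)
import Data.Nat.Tactic.RingSolver as ℕ-Solver
import Data.Integer.Tactic.RingSolver as ℤ-Solver

private
  variable
    n : ℕ

𝟙 : Bool → ℕ
𝟙 true  = 1
𝟙 false = 0

χ : Subset n → Fin n → ℕ
χ A x = 𝟙 (lookup A x)

χ-∈ : ∀ {A : Subset n} {x} → x ∈ A → χ A x ≡ 1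
χ-∈ x∈A rewrite []=⇒lookup x∈A = refl

χ-∉ : ∀ {A : Subset n} {x} → x ∉ A → χ A x ≡ 0
χ-∉ {A = A} {x} x∉A with lookup A x in eq
... | true  = contradiction (lookup⇒[]= x A eq) x∉A
... | false = refl

χ≤1 : ∀ (A : Subset n) x → χ A x ≤ 1
χ≤1 A x with lookup A x
... | true  = ≤-refl
... | false = z≤n

χ-cong : ∀ {A B : Subset n} {x y} → (x ∈ A → y ∈ B) → (y ∈ B → x ∈ A) → χ A x ≡ χ B y
χ-cong {A = A} {B} {x} {y} to from with x ∈? A | y ∈? B
... | yes x∈A | _      = trans (χ-∈ x∈A) (sym (χ-∈ (to x∈A)))
... | no x∉A | yes y∈B = contradiction (from y∈B) x∉A
... | no x∉A | no y∉B  = trans (χ-∉ x∉A) (sym (χ-∉ y∉B))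

χ-∩ : ∀ (A B : Subset n) x → χ (A ∩ B) x ≡ χ A x * χ B x
χ-∩ A B x = trans (cong 𝟙 (lookup-zipWith _∧_ x A B)) (𝟙-∧ (lookup A x) (lookup B x))
  where
  𝟙-∧ : ∀ p q → 𝟙 (p ∧ q) ≡ 𝟙 p * 𝟙 q
  𝟙-∧ true  true  = refl
  𝟙-∧ true  false = refl
  𝟙-∧ false _     = refl

χ-∪ : ∀ (A B : Subset n) x → χ (A ∪ B) x + χ (A ∩ B) x ≡ χ A x + χ B x
χ-∪ A B x rewrite lookup-zipWith _∨_ x A B | lookup-zipWith _∧_ x A B =
  𝟙-∨ (lookup A x) (lookup B x)
  where
  𝟙-∨ : ∀ p q → 𝟙 (p ∨ q) + 𝟙 (p ∧ q) ≡ 𝟙 p + 𝟙 q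
  𝟙-∨ true  true  = refl
  𝟙-∨ true  false = refl
  𝟙-∨ false true  = refl
  𝟙-∨ false false = refl

∑χ≡∣∣ : ∀ (A : Subset n) → sum (χ A) ≡ ∣ A ∣
∑χ≡∣∣ []          = refl
∑χ≡∣∣ (true ∷ A)  = cong suc (∑χ≡∣∣ A)
∑χ≡∣∣ (false ∷ A) = ∑χ≡∣∣ A

∑χ*χ≡∣∩∣ : ∀ (A B : Subset n) → sum (λ x → χ A x * χ B x) ≡ ∣ A ∩ B ∣
∑χ*χ≡∣∩∣ A B = trans (sum-cong-≗ (λ x → sym (χ-∩ A B x))) (∑χ≡∣∣ (A ∩ B))

∣∪∣+∣∩∣≡∣∣+∣∣ : ∀ (A B : Subset n) → ∣ A ∪ B ∣ + ∣ A ∩ B ∣ ≡ ∣ A ∣ + ∣ B ∣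
∣∪∣+∣∩∣≡∣∣+∣∣ A B = begin
  ∣ A ∪ B ∣ + ∣ A ∩ B ∣               ≡⟨ cong₂ _+_ (∑χ≡∣∣ (A ∪ B)) (∑χ≡∣∣ (A ∩ B)) ⟨
  sum (χ (A ∪ B)) + sum (χ (A ∩ B))   ≡⟨ ∑-distrib-+ (χ (A ∪ B)) (χ (A ∩ B)) ⟨
  sum (λ x → χ (A ∪ B) x + χ (A ∩ B) x) ≡⟨ sum-cong-≗ (χ-∪ A B) ⟩
  sum (λ x → χ A x + χ B x)           ≡⟨ ∑-distrib-+ (χ A) (χ B) ⟩
  sum (χ A) + sum (χ B)               ≡⟨ cong₂ _+_ (∑χ≡∣∣ A) (∑χ≡∣∣ B) ⟩
  ∣ A ∣ + ∣ B ∣                       ∎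
  where open ≡-Reasoning

∣∪∣≡∣∣+∣∣ : ∀ {A B : Subset n} → (∀ x → x ∈ A → x ∉ B) → ∣ A ∪ B ∣ ≡ ∣ A ∣ + ∣ B ∣
∣∪∣≡∣∣+∣∣ {n = n} {A = A} {B} disjoint = begin
  ∣ A ∪ B ∣             ≡⟨ +-identityʳ _ ⟨
  ∣ A ∪ B ∣ + 0         ≡⟨ cong (λ m → ∣ A ∪ B ∣ + m) ∣A∩B∣≡0 ⟨
  ∣ A ∪ B ∣ + ∣ A ∩ B ∣ ≡⟨ ∣∪∣+∣∩∣≡∣∣+∣∣ A B ⟩
  ∣ A ∣ + ∣ B ∣         ∎
  where
  open ≡-Reasoning
  ∣A∩B∣≡0 : ∣ A ∩ B ∣ ≡ 0
  ∣A∩B∣≡0 = trans (cong ∣_∣ (Empty-unique λ (x , x∈A∩B) →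
                    let (x∈A , x∈B) = x∈p∩q⁻ A B x∈A∩B in disjoint x x∈A x∈B))
                  (∣⊥∣≡0 n)

∣∪∩∣≡∣∩∣+∣∩∣ : ∀ {A B : Subset n} C → (∀ x → x ∈ A → x ∉ B) → ∣ (A ∪ B) ∩ C ∣ ≡ ∣ A ∩ C ∣ + ∣ B ∩ C ∣
∣∪∩∣≡∣∩∣+∣∩∣ {A = A} {B} C disjoint = trans (cong ∣_∣ (∩-distribʳ-∪ C A B))
  (∣∪∣≡∣∣+∣∣ λ x x∈A∩C x∈B∩C → disjoint x (p∩q⊆p A C x∈A∩C) (p∩q⊆p B C x∈B∩C))

∣∩∣+∣∩∁∣≡∣∣ : ∀ (A B : Subset n) → ∣ A ∩ B ∣ + ∣ A ∩ ∁ B ∣ ≡ ∣ A ∣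
∣∩∣+∣∩∁∣≡∣∣ A B = begin
  ∣ A ∩ B ∣ + ∣ A ∩ ∁ B ∣   ≡⟨ ∣∪∣≡∣∣+∣∣ disjoint ⟨
  ∣ A ∩ B ∪ A ∩ ∁ B ∣       ≡⟨ cong ∣_∣ (∩-distribˡ-∪ A B (∁ B)) ⟨
  ∣ A ∩ (B ∪ ∁ B) ∣         ≡⟨ cong (λ C → ∣ A ∩ C ∣) (p∪∁p≡⊤ B) ⟩
  ∣ A ∩ ⊤ ∣                 ≡⟨ cong ∣_∣ (∩-identityʳ A) ⟩
  ∣ A ∣                     ∎
  where
  open ≡-Reasoning
  disjoint : ∀ x → x ∈ A ∩ B → x ∉ A ∩ ∁ B
  disjoint x x∈A∩B x∈A∩∁B =
    x∈p⇒x∉∁p (proj₂ (x∈p∩q⁻ A B x∈A∩B)) (proj₂ (x∈p∩q⁻ A (∁ B) x∈A∩∁B))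

∑-const : ∀ n c → sum {n} (λ _ → c) ≡ n * c
∑-const ℕ.zero    c = refl
∑-const (ℕ.suc n) c = cong (λ m → c + m) (∑-const n c)

∑-mono-≤ : ∀ {f g : Fin n → ℕ} → (∀ i → f i ≤ g i) → sum f ≤ sum g
∑-mono-≤ {n = ℕ.zero}  f≤g = z≤n
∑-mono-≤ {n = ℕ.suc n} f≤g = +-mono-≤ (f≤g Fin.zero) (∑-mono-≤ (λ i → f≤g (Fin.suc i)))

term≤∑ : ∀ (f : Fin n → ℕ) i → f i ≤ sum f
term≤∑ {n = ℕ.suc n} f i = ≤-trans (m≤m+n (f i) _) (≤-reflexive (sym (sum-remove f)))

pointwise-≤∧∑-≥⇒≡ : ∀ {f g : Fin n → ℕ} → (∀ i → f i ≤ g i) → sum g ≤ sum f → ∀ i → f i ≡ g i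
pointwise-≤∧∑-≥⇒≡ {f = f} {g} f≤g ∑g≤∑f i =
  ≤-antisym (f≤g i) (m∸n≡0⇒m≤n (n≤0⇒n≡0 (≤-trans (term≤∑ excess i) ∑excess≤0)))
  where
  excess : Fin _ → ℕ
  excess j = g j ∸ f j
  ∑excess≤0 : sum excess ≤ 0
  ∑excess≤0 = +-cancelˡ-≤ (sum f) (sum excess) 0 (begin
    sum f + sum excess          ≡⟨ ∑-distrib-+ f excess ⟨
    sum (λ j → f j + excess j)  ≡⟨ sum-cong-≗ (λ j → m+[n∸m]≡n (f≤g j)) ⟩
    sum g                       ≤⟨ ∑g≤∑f ⟩
    sum f                       ≡⟨ +-identityʳ (sum f) ⟨
    sum f + 0                   ∎)
    where open ≤-Reasoning

∑-sift : ∀ (e : Fin n) (f : Fin n → ℕ) → sum (λ x → χ ⁅ e ⁆ x * f x) ≡ f e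
∑-sift e f = begin
  sum (λ x → χ ⁅ e ⁆ x * f x)  ≡⟨ sum-cong-≗ sift ⟩
  sum (λ x → χ ⁅ e ⁆ x * f e)  ≡⟨ *-distribʳ-sum (f e) (χ ⁅ e ⁆) ⟨
  sum (χ ⁅ e ⁆) * f e          ≡⟨ cong (_* f e) (trans (∑χ≡∣∣ ⁅ e ⁆) (∣⁅x⁆∣≡1 e)) ⟩
  1 * f e                      ≡⟨ *-identityˡ (f e) ⟩
  f e                          ∎
  where
  open ≡-Reasoning
  sift : ∀ x → χ ⁅ e ⁆ x * f x ≡ χ ⁅ e ⁆ x * f e
  sift x with x ≟ e
  ... | yes refl = refl
  ... | no x≢e   = trans (cong (_* f x) χ≡0) (sym (cong (_* f e) χ≡0))
    where
    χ≡0 : χ ⁅ e ⁆ x ≡ 0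
    χ≡0 = χ-∉ (x≢y⇒x∉⁅y⁆ x≢e)

*-distribˡ-+-assoc : ∀ c h d a b → c * (h * a + d * b) ≡ c * h * a + c * d * b
*-distribˡ-+-assoc = ℕ-Solver.solve-∀

*-distribʳ-+₃ : ∀ h p q w → (p + q + w) * h ≡ p * h + q * h + w * h
*-distribʳ-+₃ = ℕ-Solver.solve-∀

moore-order-identity : ∀ z r → 1 + (z + r) + (z + r) * (z + r) ≡ (z + r) * ((z + r) * 1) + z + 1 + r
moore-order-identity = ℕ-Solver.solve-∀

module _ (G : FiniteGroup n) where
  open FiniteGroup G
  open IsGroup isGroup using (identityˡ; identityʳ)
  private
    group : Group 0ℓ 0ℓ
    group = record { isGroup = isGroup }

  open GroupProperties group using (\\-leftDividesˡ; \\-leftDividesʳ; //-rightDividesʳ)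

  ∑-translate : ∀ s (f : Fin n → ℕ) → sum (λ y → f (s ∙ y)) ≡ sum f
  ∑-translate s f = sym (∑-permute f (permutation (s ∙_) (s ⁻¹ ∙_) (\\-leftDividesˡ s) (\\-leftDividesʳ s)))

  walks₂ : Subset n → Fin n → ℕ
  walks₂ S x = sum (λ s → χ S s * χ S (s ⁻¹ ∙ x))

  ∑-walks₂-* : ∀ S (f : Fin n → ℕ) →
    sum (λ x → walks₂ S x * f x) ≡ sum (λ s → χ S s * sum (λ y → χ S y * f (s ∙ y)))
  ∑-walks₂-* S f = begin
    sum (λ x → walks₂ S x * f x)
      ≡⟨ sum-cong-≗ (λ x → *-distribʳ-sum (f x) (λ s → χ S s * χ S (s ⁻¹ ∙ x))) ⟩
    sum (λ x → sum (λ s → χ S s * χ S (s ⁻¹ ∙ x) * f x))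
      ≡⟨ ∑-comm (λ x s → χ S s * χ S (s ⁻¹ ∙ x) * f x) ⟩
    sum (λ s → sum (λ x → χ S s * χ S (s ⁻¹ ∙ x) * f x))
      ≡⟨ sum-cong-≗ (λ s → sum-cong-≗ (λ x → *-assoc (χ S s) (χ S (s ⁻¹ ∙ x)) (f x))) ⟩
    sum (λ s → sum (λ x → χ S s * (χ S (s ⁻¹ ∙ x) * f x)))
      ≡⟨ sum-cong-≗ (λ s → *-distribˡ-sum (χ S s) (λ x → χ S (s ⁻¹ ∙ x) * f x)) ⟨
    sum (λ s → χ S s * sum (λ x → χ S (s ⁻¹ ∙ x) * f x))
      ≡⟨ sum-cong-≗ (λ s → cong (χ S s *_) (sym (∑-translate s (λ x → χ S (s ⁻¹ ∙ x) * f x)))) ⟩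
    sum (λ s → χ S s * sum (λ y → χ S (s ⁻¹ ∙ (s ∙ y)) * f (s ∙ y)))
      ≡⟨ sum-cong-≗ (λ s → cong (χ S s *_) (sum-cong-≗ (λ y →
           cong (λ t → χ S t * f (s ∙ y)) (\\-leftDividesʳ s y)))) ⟩
    sum (λ s → χ S s * sum (λ y → χ S y * f (s ∙ y)))
      ∎
    where open ≡-Reasoning

  ∑-walks₂ : ∀ S → sum (walks₂ S) ≡ ∣ S ∣ * ∣ S ∣
  ∑-walks₂ S = begin
    sum (walks₂ S)                                    ≡⟨ sum-cong-≗ (λ x → *-identityʳ (walks₂ S x)) ⟨
    sum (λ x → walks₂ S x * 1)                        ≡⟨ ∑-walks₂-* S (λ _ → 1) ⟩
    sum (λ s → χ S s * sum (λ y → χ S y * 1))         ≡⟨ sum-cong-≗ (λ s → cong (χ S s *_) ∑χ*1≡∣S∣) ⟩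
    sum (λ s → χ S s * ∣ S ∣)                         ≡⟨ *-distribʳ-sum ∣ S ∣ (χ S) ⟨
    sum (χ S) * ∣ S ∣                                 ≡⟨ cong (_* ∣ S ∣) (∑χ≡∣∣ S) ⟩
    ∣ S ∣ * ∣ S ∣                                     ∎
    where
    open ≡-Reasoning
    ∑χ*1≡∣S∣ : sum (λ y → χ S y * 1) ≡ ∣ S ∣
    ∑χ*1≡∣S∣ = trans (sum-cong-≗ (λ y → *-identityʳ (χ S y))) (∑χ≡∣∣ S)

  walks₂-∙ : ∀ {S s t} → s ∈ S → t ∈ S → 1 ≤ walks₂ S (s ∙ t)
  walks₂-∙ {S} {s} {t} s∈S t∈S = ≤-trans (≤-reflexive (sym term≡1)) (term≤∑ _ s)
    where
    term≡1 : χ S s * χ S (s ⁻¹ ∙ (s ∙ t)) ≡ 1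
    term≡1 = cong₂ _*_ (χ-∈ s∈S) (trans (cong (χ S) (\\-leftDividesʳ s t)) (χ-∈ t∈S))

  ∣∣≤walks₂-ε : ∀ {A S} → InverseClosed G A → A ⊆ S → ∣ A ∣ ≤ walks₂ S ε
  ∣∣≤walks₂-ε {A} {S} A⁻¹⊆A A⊆S = ≤-trans (≤-reflexive (sym (∑χ≡∣∣ A))) (∑-mono-≤ closing)
    where
    closing : ∀ s → χ A s ≤ χ S s * χ S (s ⁻¹ ∙ ε)
    closing s with s ∈? A
    ... | no s∉A  = ≤-trans (≤-reflexive (χ-∉ s∉A)) z≤n
    ... | yes s∈A = ≤-reflexive (trans (χ-∈ s∈A) (sym (cong₂ _*_ (χ-∈ (A⊆S s∈A))
                      (trans (cong (χ S) (identityʳ (s ⁻¹))) (χ-∈ (A⊆S (A⁻¹⊆A s s∈A)))))))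

  walks≤₂ : Subset n → Fin n → ℕ
  walks≤₂ S x = χ ⁅ ε ⁆ x + χ S x + walks₂ S x

  ∑-walks≤₂ : ∀ S → sum (walks≤₂ S) ≡ 1 + ∣ S ∣ + ∣ S ∣ * ∣ S ∣
  ∑-walks≤₂ S = begin
    sum (walks≤₂ S)                                       ≡⟨ ∑-distrib-+ (λ x → χ ⁅ ε ⁆ x + χ S x) (walks₂ S) ⟩
    sum (λ x → χ ⁅ ε ⁆ x + χ S x) + sum (walks₂ S)        ≡⟨ cong (_+ sum (walks₂ S)) (∑-distrib-+ (χ ⁅ ε ⁆) (χ S)) ⟩
    sum (χ ⁅ ε ⁆) + sum (χ S) + sum (walks₂ S)            ≡⟨ cong₂ (λ k l → k + sum (χ S) + l) ∑χ⁅ε⁆≡1 (∑-walks₂ S) ⟩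
    1 + sum (χ S) + ∣ S ∣ * ∣ S ∣                         ≡⟨ cong (λ k → 1 + k + ∣ S ∣ * ∣ S ∣) (∑χ≡∣∣ S) ⟩
    1 + ∣ S ∣ + ∣ S ∣ * ∣ S ∣                             ∎
    where
    open ≡-Reasoning
    ∑χ⁅ε⁆≡1 : sum (χ ⁅ ε ⁆) ≡ 1
    ∑χ⁅ε⁆≡1 = trans (∑χ≡∣∣ ⁅ ε ⁆) (∣⁅x⁆∣≡1 ε)

  walks≤₂-≥1 : ∀ {S} → DiameterAtMost2 G S → ∀ x → 1 ≤ walks≤₂ S x
  walks≤₂-≥1 {S} diameter x with diameter ε x
  ... | inj₁ refl =
    ≤-trans (≤-reflexive (sym (χ-∈ (x∈⁅x⁆ ε)))) (≤-trans (m≤m+n _ (χ S ε)) (m≤m+n _ (walks₂ S ε)))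
  ... | inj₂ (inj₁ (s , s∈S , refl)) =
    ≤-trans (≤-reflexive (sym (χ-∈ (subst (_∈ S) (sym (identityˡ s)) s∈S))))
            (≤-trans (m≤n+m _ (χ ⁅ ε ⁆ (ε ∙ s))) (m≤m+n _ (walks₂ S (ε ∙ s))))
  ... | inj₂ (inj₂ (_ , (s , s∈S , refl) , (t , t∈S , refl))) =
    ≤-trans (subst (λ y → 1 ≤ walks₂ S (y ∙ t)) (sym (identityˡ s)) (walks₂-∙ s∈S t∈S))
            (m≤n+m _ (χ ⁅ ε ⁆ (ε ∙ s ∙ t) + χ S (ε ∙ s ∙ t)))

  module _ {H : Subset n} (ε∈H : ε ∈ H) (∙-closed : ∀ x y → x ∈ H → y ∈ H → x ∙ y ∈ H)
           (⁻¹-closed : ∀ x → x ∈ H → x ⁻¹ ∈ H) (2∣H∣≡n : 2 * ∣ H ∣ ≡ n) where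
    private
      ∣∁H∣≡∣H∣ : ∣ ∁ H ∣ ≡ ∣ H ∣
      ∣∁H∣≡∣H∣ = begin
        ∣ ∁ H ∣                      ≡⟨ ∣∁p∣≡n∸∣p∣ H ⟩
        n ∸ ∣ H ∣                    ≡⟨ cong (_∸ ∣ H ∣) 2∣H∣≡n ⟨
        ∣ H ∣ + (∣ H ∣ + 0) ∸ ∣ H ∣  ≡⟨ m+n∸m≡n ∣ H ∣ (∣ H ∣ + 0) ⟩
        ∣ H ∣ + 0                    ≡⟨ +-identityʳ ∣ H ∣ ⟩
        ∣ H ∣                        ∎
        where open ≡-Reasoning

    χ-∙-∈ : ∀ {s} → s ∈ H → ∀ y → χ H (s ∙ y) ≡ χ H y
    χ-∙-∈ {s} s∈H y = χ-cong
      (λ s∙y∈H → subst (_∈ H) (\\-leftDividesʳ s y) (∙-closed _ _ (⁻¹-closed s s∈H) s∙y∈H))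
      (∙-closed s y s∈H)

    -- For s ∉ H the coset s H avoids H and has |H| = |∁ H| elements, so it is all of ∁ H.
    χ-∙-∉ : ∀ {s} → s ∉ H → ∀ y → χ H (s ∙ y) ≡ χ (∁ H) y
    χ-∙-∉ {s} s∉H = pointwise-≤∧∑-≥⇒≡ coset⊆∁H (≤-reflexive ∣∁H∣≡∣sH∣)
      where
      coset⊆∁H : ∀ y → χ H (s ∙ y) ≤ χ (∁ H) y
      coset⊆∁H y with y ∈? H
      ... | yes y∈H = ≤-trans (≤-reflexive (χ-∉ s∙y∉H)) z≤n
        where
        s∙y∉H : s ∙ y ∉ H
        s∙y∉H s∙y∈H = s∉H (subst (_∈ H) (//-rightDividesʳ y s) (∙-closed _ _ s∙y∈H (⁻¹-closed y y∈H)))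
      ... | no y∉H  = ≤-trans (χ≤1 H (s ∙ y)) (≤-reflexive (sym (χ-∈ (x∉p⇒x∈∁p y∉H))))
      ∣∁H∣≡∣sH∣ : sum (χ (∁ H)) ≡ sum (λ y → χ H (s ∙ y))
      ∣∁H∣≡∣sH∣ = trans (∑χ≡∣∣ (∁ H)) (trans ∣∁H∣≡∣H∣ (trans (sym (∑χ≡∣∣ H)) (sym (∑-translate s (χ H)))))

    module _ (S : Subset n) where
      private
        a b : ℕ
        a = ∣ S ∩ H ∣
        b = ∣ S ∩ ∁ H ∣

      ∑-χ*χ-∙ : ∀ s → sum (λ y → χ S y * χ H (s ∙ y)) ≡ χ H s * a + χ (∁ H) s * b
      ∑-χ*χ-∙ s with s ∈? H
      ... | yes s∈H = begin
        sum (λ y → χ S y * χ H (s ∙ y))  ≡⟨ sum-cong-≗ (λ y → cong (χ S y *_) (χ-∙-∈ s∈H y)) ⟩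
        sum (λ y → χ S y * χ H y)        ≡⟨ ∑χ*χ≡∣∩∣ S H ⟩
        a                                ≡⟨ trans (cong₂ _+_ (*-identityˡ a) (*-zeroˡ b)) (+-identityʳ a) ⟨
        1 * a + 0 * b                    ≡⟨ cong₂ (λ i j → i * a + j * b) (χ-∈ s∈H) (χ-∉ (x∈p⇒x∉∁p s∈H)) ⟨
        χ H s * a + χ (∁ H) s * b        ∎
        where open ≡-Reasoning
      ... | no s∉H  = begin
        sum (λ y → χ S y * χ H (s ∙ y))  ≡⟨ sum-cong-≗ (λ y → cong (χ S y *_) (χ-∙-∉ s∉H y)) ⟩
        sum (λ y → χ S y * χ (∁ H) y)    ≡⟨ ∑χ*χ≡∣∩∣ S (∁ H) ⟩
        b                                ≡⟨ cong₂ _+_ (*-zeroˡ a) (*-identityˡ b) ⟨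
        0 * a + 1 * b                    ≡⟨ cong₂ (λ i j → i * a + j * b) (χ-∉ s∉H) (χ-∈ (x∉p⇒x∈∁p s∉H)) ⟨
        χ H s * a + χ (∁ H) s * b        ∎
        where open ≡-Reasoning

      ∑-walks₂-*χ : sum (λ x → walks₂ S x * χ H x) ≡ a * a + b * b
      ∑-walks₂-*χ = begin
        sum (λ x → walks₂ S x * χ H x)
          ≡⟨ ∑-walks₂-* S (χ H) ⟩
        sum (λ s → χ S s * sum (λ y → χ S y * χ H (s ∙ y)))
          ≡⟨ sum-cong-≗ (λ s → cong (χ S s *_) (∑-χ*χ-∙ s)) ⟩
        sum (λ s → χ S s * (χ H s * a + χ (∁ H) s * b))
          ≡⟨ sum-cong-≗ split ⟩
        sum (λ s → χ (S ∩ H) s * a + χ (S ∩ ∁ H) s * b)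
          ≡⟨ ∑-distrib-+ (λ s → χ (S ∩ H) s * a) (λ s → χ (S ∩ ∁ H) s * b) ⟩
        sum (λ s → χ (S ∩ H) s * a) + sum (λ s → χ (S ∩ ∁ H) s * b)
          ≡⟨ cong₂ _+_ (*-distribʳ-sum a (χ (S ∩ H))) (*-distribʳ-sum b (χ (S ∩ ∁ H))) ⟨
        sum (χ (S ∩ H)) * a + sum (χ (S ∩ ∁ H)) * b
          ≡⟨ cong₂ (λ i j → i * a + j * b) (∑χ≡∣∣ (S ∩ H)) (∑χ≡∣∣ (S ∩ ∁ H)) ⟩
        a * a + b * b
          ∎
        where
        open ≡-Reasoning
        split : ∀ s → χ S s * (χ H s * a + χ (∁ H) s * b) ≡ χ (S ∩ H) s * a + χ (S ∩ ∁ H) s * b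
        split s = begin
          χ S s * (χ H s * a + χ (∁ H) s * b)          ≡⟨ *-distribˡ-+-assoc (χ S s) (χ H s) (χ (∁ H) s) a b ⟩
          χ S s * χ H s * a + χ S s * χ (∁ H) s * b    ≡⟨ cong₂ (λ i j → i * a + j * b) (χ-∩ S H s) (χ-∩ S (∁ H) s) ⟨
          χ (S ∩ H) s * a + χ (S ∩ ∁ H) s * b          ∎

      ∑-walks≤₂-*χ : sum (λ x → walks≤₂ S x * χ H x) ≡ 1 + a + (a * a + b * b)
      ∑-walks≤₂-*χ = begin
        sum (λ x → walks≤₂ S x * χ H x)
          ≡⟨ sum-cong-≗ (λ x → *-distribʳ-+₃ (χ H x) (χ ⁅ ε ⁆ x) (χ S x) (walks₂ S x)) ⟩
        sum (λ x → (χ ⁅ ε ⁆ x * χ H x + χ S x * χ H x) + walks₂ S x * χ H x)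
          ≡⟨ ∑-distrib-+ (λ x → χ ⁅ ε ⁆ x * χ H x + χ S x * χ H x) (λ x → walks₂ S x * χ H x) ⟩
        sum (λ x → χ ⁅ ε ⁆ x * χ H x + χ S x * χ H x) + sum (λ x → walks₂ S x * χ H x)
          ≡⟨ cong (_+ sum (λ x → walks₂ S x * χ H x)) (∑-distrib-+ (λ x → χ ⁅ ε ⁆ x * χ H x) (λ x → χ S x * χ H x)) ⟩
        sum (λ x → χ ⁅ ε ⁆ x * χ H x) + sum (λ x → χ S x * χ H x) + sum (λ x → walks₂ S x * χ H x)
          ≡⟨ cong₂ _+_ (cong₂ _+_ (trans (∑-sift ε (χ H)) (χ-∈ ε∈H)) (∑χ*χ≡∣∩∣ S H)) ∑-walks₂-*χ ⟩
        1 + a + (a * a + b * b)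
          ∎
        where open ≡-Reasoning

  module _ {r z : ℕ} {S₁ S₂ : Subset n}
           (n≡ : n ≡ (z + r) ^ 2 + z + 1) (disjoint : ∀ x → x ∈ S₁ → x ∉ S₂)
           (S₁⁻¹⊆S₁ : InverseClosed G S₁) (∣S₁∣≡r : ∣ S₁ ∣ ≡ r) (∣S₂∣≡z : ∣ S₂ ∣ ≡ z)
           (diameter : DiameterAtMost2 G (S₁ ∪ S₂)) where
    private
      S : Subset n
      S = S₁ ∪ S₂

    ∣S₁∪S₂∣≡z+r : ∣ S₁ ∪ S₂ ∣ ≡ z + r
    ∣S₁∪S₂∣≡z+r = trans (∣∪∣≡∣∣+∣∣ disjoint) (trans (cong₂ _+_ ∣S₁∣≡r ∣S₂∣≡z) (+-comm r z))

    walks≤₂-lowerBound : ∀ x → 1 + χ ⁅ ε ⁆ x * r ≤ walks≤₂ S x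
    walks≤₂-lowerBound x with x ≟ ε
    ... | yes refl = begin
      1 + χ ⁅ ε ⁆ ε * r         ≡⟨ cong (λ i → 1 + i * r) (χ-∈ (x∈⁅x⁆ ε)) ⟩
      1 + 1 * r                 ≡⟨ cong suc (*-identityˡ r) ⟩
      1 + r                     ≤⟨ +-mono-≤ (m≤m+n 1 (χ S ε)) r≤walks₂ ⟩
      1 + χ S ε + walks₂ S ε    ≡⟨ cong (λ i → i + χ S ε + walks₂ S ε) (χ-∈ (x∈⁅x⁆ ε)) ⟨
      walks≤₂ S ε               ∎
      where
      open ≤-Reasoning
      r≤walks₂ : r ≤ walks₂ S ε
      r≤walks₂ = subst (_≤ walks₂ S ε) ∣S₁∣≡r (∣∣≤walks₂-ε S₁⁻¹⊆S₁ (p⊆p∪q S₂))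
    ... | no x≢ε = subst (_≤ walks≤₂ S x) (cong (λ i → 1 + i * r) (sym (χ-∉ (x≢y⇒x∉⁅y⁆ x≢ε))))
                         (walks≤₂-≥1 diameter x)

    -- Counting both sides gives n + r, so the lower bound is attained everywhere.
    walks≤₂-moore : ∀ x → walks≤₂ S x ≡ 1 + χ ⁅ ε ⁆ x * r
    walks≤₂-moore x = sym (pointwise-≤∧∑-≥⇒≡ walks≤₂-lowerBound (≤-reflexive ∑walks≤₂≡∑bound) x)
      where
      open ≡-Reasoning
      ∑walks≤₂≡∑bound : sum (walks≤₂ S) ≡ sum (λ x → 1 + χ ⁅ ε ⁆ x * r)
      ∑walks≤₂≡∑bound = begin
        sum (walks≤₂ S)                                  ≡⟨ ∑-walks≤₂ S ⟩
        1 + ∣ S ∣ + ∣ S ∣ * ∣ S ∣                        ≡⟨ cong (λ k → 1 + k + k * k) ∣S₁∪S₂∣≡z+r ⟩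
        1 + (z + r) + (z + r) * (z + r)                  ≡⟨ moore-order-identity z r ⟩
        (z + r) ^ 2 + z + 1 + r                          ≡⟨ cong (_+ r) n≡ ⟨
        n + r                                            ≡⟨ cong₂ _+_ (*-identityʳ n) (∑-sift ε (λ _ → r)) ⟨
        n * 1 + sum (λ x → χ ⁅ ε ⁆ x * r)                ≡⟨ cong (_+ sum (λ x → χ ⁅ ε ⁆ x * r)) (∑-const n 1) ⟨
        sum {n} (λ _ → 1) + sum (λ x → χ ⁅ ε ⁆ x * r)    ≡⟨ ∑-distrib-+ (λ _ → 1) (λ x → χ ⁅ ε ⁆ x * r) ⟨
        sum (λ x → 1 + χ ⁅ ε ⁆ x * r)                    ∎

    module _ {H : Subset n} (ε∈H : ε ∈ H) (∙-closed : ∀ x y → x ∈ H → y ∈ H → x ∙ y ∈ H)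
             (⁻¹-closed : ∀ x → x ∈ H → x ⁻¹ ∈ H) (2∣H∣≡n : 2 * ∣ H ∣ ≡ n) where
      private
        a b : ℕ
        a = ∣ S ∩ H ∣
        b = ∣ S ∩ ∁ H ∣

      moore-index2-count : 1 + a + (a * a + b * b) ≡ ∣ H ∣ + r
      moore-index2-count = begin
        1 + a + (a * a + b * b)
          ≡⟨ ∑-walks≤₂-*χ ε∈H ∙-closed ⁻¹-closed 2∣H∣≡n S ⟨
        sum (λ x → walks≤₂ S x * χ H x)
          ≡⟨ sum-cong-≗ (λ x → cong (_* χ H x) (walks≤₂-moore x)) ⟩
        sum (λ x → (1 + χ ⁅ ε ⁆ x * r) * χ H x)
          ≡⟨ sum-cong-≗ (λ x → trans (*-distribʳ-+ (χ H x) 1 (χ ⁅ ε ⁆ x * r))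
                                     (cong₂ _+_ (*-identityˡ (χ H x)) (*-assoc (χ ⁅ ε ⁆ x) r (χ H x)))) ⟩
        sum (λ x → χ H x + χ ⁅ ε ⁆ x * (r * χ H x))
          ≡⟨ ∑-distrib-+ (χ H) (λ x → χ ⁅ ε ⁆ x * (r * χ H x)) ⟩
        sum (χ H) + sum (λ x → χ ⁅ ε ⁆ x * (r * χ H x))
          ≡⟨ cong₂ _+_ (∑χ≡∣∣ H) (∑-sift ε (λ x → r * χ H x)) ⟩
        ∣ H ∣ + r * χ H ε
          ≡⟨ cong (λ i → ∣ H ∣ + r * i) (χ-∈ ε∈H) ⟩
        ∣ H ∣ + r * 1
          ≡⟨ cong (λ i → ∣ H ∣ + i) (*-identityʳ r) ⟩
        ∣ H ∣ + r
          ∎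
        where open ≡-Reasoning

-- The Moore count rewritten as r = (a - b)² + (a - b) + 1, without subtraction.
moore-parameter-identity : ∀ a b h r z → 1 + a + (a * a + b * b) ≡ h + r →
  2 * h ≡ (z + r) ^ 2 + z + 1 → z + r ≡ a + b → r + 2 * (a * b) + b ≡ a * a + b * b + a + 1
moore-parameter-identity a b h r z count 2h≡ z+r≡a+b = +-cancelʳ-≡ q _ q (begin
  r + 2 * (a * b) + b + q          ≡⟨ expand-square a b r ⟩
  (a + b) * (a + b) + (a + b) + 1 + r ≡⟨ cong (λ k → k * k + k + 1 + r) z+r≡a+b ⟨
  (z + r) * (z + r) + (z + r) + 1 + r ≡⟨ regroup z r ⟩
  (z + r) ^ 2 + z + 1 + 2 * r      ≡⟨ cong (_+ 2 * r) 2h≡ ⟨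
  2 * h + 2 * r                    ≡⟨ *-distribˡ-+ 2 h r ⟨
  2 * (h + r)                      ≡⟨ cong (2 *_) count ⟨
  2 * (1 + a + (a * a + b * b))    ≡⟨ double a b ⟩
  q + q                            ∎)
  where
  open ≡-Reasoning
  q : ℕ
  q = a * a + b * b + a + 1
  expand-square : ∀ a b r → r + 2 * (a * b) + b + (a * a + b * b + a + 1) ≡ (a + b) * (a + b) + (a + b) + 1 + r
  expand-square = ℕ-Solver.solve-∀
  regroup : ∀ z r → (z + r) * (z + r) + (z + r) + 1 + r ≡ (z + r) * ((z + r) * 1) + z + 1 + 2 * r
  regroup = ℕ-Solver.solve-∀
  double : ∀ a b → 2 * (1 + a + (a * a + b * b)) ≡ (a * a + b * b + a + 1) + (a * a + b * b + a + 1)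
  double = ℕ-Solver.solve-∀

odd-square-identity : ∀ (A B R : ℤ) → R +ℤ + 2 *ℤ (A *ℤ B) +ℤ B ≡ A *ℤ A +ℤ B *ℤ B +ℤ A +ℤ + 1 →
  let u = + 4 *ℤ A -ℤ + 2 *ℤ (A +ℤ B) +ℤ + 1 in u *ℤ u ≡ + 4 *ℤ R -ℤ + 3
odd-square-identity A B R eq = begin
  u *ℤ u                                                                  ≡⟨ square A B ⟩
  + 4 *ℤ (A *ℤ A +ℤ B *ℤ B +ℤ A +ℤ + 1) -ℤ + 4 *ℤ (+ 2 *ℤ (A *ℤ B) +ℤ B) -ℤ + 3
    ≡⟨ cong (λ t → + 4 *ℤ t -ℤ + 4 *ℤ (+ 2 *ℤ (A *ℤ B) +ℤ B) -ℤ + 3) eq ⟨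
  + 4 *ℤ (R +ℤ + 2 *ℤ (A *ℤ B) +ℤ B) -ℤ + 4 *ℤ (+ 2 *ℤ (A *ℤ B) +ℤ B) -ℤ + 3 ≡⟨ cancel A B R ⟩
  + 4 *ℤ R -ℤ + 3                                                         ∎
  where
  open ≡-Reasoning
  u : ℤ
  u = + 4 *ℤ A -ℤ + 2 *ℤ (A +ℤ B) +ℤ + 1
  square : ∀ A B → let u = + 4 *ℤ A -ℤ + 2 *ℤ (A +ℤ B) +ℤ + 1 in
    u *ℤ u ≡ + 4 *ℤ (A *ℤ A +ℤ B *ℤ B +ℤ A +ℤ + 1) -ℤ + 4 *ℤ (+ 2 *ℤ (A *ℤ B) +ℤ B) -ℤ + 3
  square = ℤ-Solver.solve-∀
  cancel : ∀ A B R → + 4 *ℤ (R +ℤ + 2 *ℤ (A *ℤ B) +ℤ B) -ℤ + 4 *ℤ (+ 2 *ℤ (A *ℤ B) +ℤ B) -ℤ + 3 ≡ + 4 *ℤ R -ℤ + 3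
  cancel = ℤ-Solver.solve-∀

odd-square-identityℕ : ∀ {s k} a b r → s ≡ a → k ≡ a + b → r + 2 * (a * b) + b ≡ a * a + b * b + a + 1 →
  let u = + (4 * s) -ℤ + (2 * k) +ℤ + 1 in u *ℤ u ≡ + (4 * r) -ℤ + 3
odd-square-identityℕ a b r refl refl eq = begin
  u *ℤ u                                   ≡⟨ cong (λ t → t *ℤ t) u≡ ⟩
  v *ℤ v                                   ≡⟨ odd-square-identity (+ a) (+ b) (+ r) eqℤ ⟩
  + 4 *ℤ + r -ℤ + 3                        ≡⟨ cong (_-ℤ + 3) (pos-* 4 r) ⟨
  + (4 * r) -ℤ + 3                         ∎
  where
  open ≡-Reasoning
  u v : ℤ
  u = + (4 * a) -ℤ + (2 * (a + b)) +ℤ + 1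
  v = + 4 *ℤ + a -ℤ + 2 *ℤ (+ a +ℤ + b) +ℤ + 1
  u≡ : u ≡ v
  u≡ = cong (_+ℤ + 1) (cong₂ _-ℤ_ (pos-* 4 a) (trans (pos-* 2 (a + b)) (cong (+ 2 *ℤ_) (pos-+ a b))))
  castˡ : + (r + 2 * (a * b) + b) ≡ + r +ℤ + 2 *ℤ (+ a *ℤ + b) +ℤ + b
  castˡ = trans (pos-+ (r + 2 * (a * b)) b) (cong (_+ℤ + b) (trans (pos-+ r (2 * (a * b)))
            (cong (λ t → + r +ℤ t) (trans (pos-* 2 (a * b)) (cong (+ 2 *ℤ_) (pos-* a b))))))
  castʳ : + (a * a + b * b + a + 1) ≡ + a *ℤ + a +ℤ + b *ℤ + b +ℤ + a +ℤ + 1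
  castʳ = trans (pos-+ (a * a + b * b + a) 1) (cong (_+ℤ + 1) (trans (pos-+ (a * a + b * b) a)
            (cong (_+ℤ + a) (trans (pos-+ (a * a) (b * b)) (cong₂ _+ℤ_ (pos-* a a) (pos-* b b))))))
  eqℤ : + r +ℤ + 2 *ℤ (+ a *ℤ + b) +ℤ + b ≡ + a *ℤ + a +ℤ + b *ℤ + b +ℤ + a +ℤ + 1
  eqℤ = trans (sym castˡ) (trans (cong +_ eq) castʳ)

proposition3 : (n r z : ℕ) (G : FiniteGroup n) (S₁ S₂ H : Subset n) →
    MixedMooreCayley G r z S₁ S₂ →
    IsSubgroupIndex2 G H →
    let u = (+ (4 * (∣ S₁ ∩ H ∣ + ∣ S₂ ∩ H ∣)) -ℤ + (2 * (z + r))) +ℤ + 1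
    in u *ℤ u ≡ + (4 * r) -ℤ + 3
proposition3 n r z G S₁ S₂ H
  (n≡ , _ , _ , disjoint , S₁⁻¹⊆S₁ , _ , ∣S₁∣≡r , ∣S₂∣≡z , diameter) (ε∈H , ∙-closed , ⁻¹-closed , 2∣H∣≡n)
  = odd-square-identityℕ a b r ∣S₁∩H∣+∣S₂∩H∣≡a z+r≡a+b
      (moore-parameter-identity a b ∣ H ∣ r z count (trans 2∣H∣≡n n≡) z+r≡a+b)
  where
  S : Subset n
  S = S₁ ∪ S₂
  a b : ℕ
  a = ∣ S ∩ H ∣
  b = ∣ S ∩ ∁ H ∣
  count : 1 + a + (a * a + b * b) ≡ ∣ H ∣ + r
  count = moore-index2-count G n≡ disjoint S₁⁻¹⊆S₁ ∣S₁∣≡r ∣S₂∣≡z diameter ε∈H ∙-closed ⁻¹-closed 2∣H∣≡n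
  ∣S₁∩H∣+∣S₂∩H∣≡a : ∣ S₁ ∩ H ∣ + ∣ S₂ ∩ H ∣ ≡ a
  ∣S₁∩H∣+∣S₂∩H∣≡a = sym (∣∪∩∣≡∣∩∣+∣∩∣ H disjoint)
  z+r≡a+b : z + r ≡ a + b
  z+r≡a+b = trans (sym (∣S₁∪S₂∣≡z+r G n≡ disjoint S₁⁻¹⊆S₁ ∣S₁∣≡r ∣S₂∣≡z diameter)) (sym (∣∩∣+∣∩∁∣≡∣∣ S H))
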